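{- Let $G$ be a connected graph and let $P$ be a path on three vertices (a $2$-path) that is vertex-disjoint from $G$. Let $G'$ be the graph obtained from the disjoint union of $G$ and $P$ by adding one edge $e$ joining a vertex of $G$ to a vertex of $P$. Then $diss(G')=diss(G)+2$.
   Context: A set $S$ of vertices of a graph $G$ is a dissociation set if the induced subgraph $G[S]$ has maximum degree at most $1$; $diss(G)$ denotes the maximum cardinality of a dissociation set of $G$. -}

module Defs where

open import Data.Nat using (ℕ; suc; _+_; _≤_)
open import Data.Fin using (Fin; zero; suc; splitAt; _≟_)
open import Data.Fin.Subset using (Subset; _∈_; ∣_∣)
open import Data.Bool using (Bool; true; false; _∧_)
open import Data.Sum using (_⊎_; inj₁; inj₂)
open import Data.Product using (Σ; _×_; ∃)
open import Relation.Nullary.Decidable using (⌊_⌋)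
open import Relation.Binary.PropositionalEquality using (_≡_)

record Graph (n : ℕ) : Set where
  field
    adj    : Fin n → Fin n → Bool
    sym    : ∀ i j → adj i j ≡ adj j i
    irrefl : ∀ i → adj i i ≡ false
open Graph public

data Walk {n : ℕ} (G : Graph n) : Fin n → Fin n → Set where
  here : ∀ {u} → Walk G u u
  step : ∀ {u w v} → adj G u w ≡ true → Walk G w v → Walk G u v

Connected : {n : ℕ} → Graph n → Set
Connected G = ∀ u v → Walk G u v

-- S is a dissociation set: G[S] has maximum degree at most 1,
-- i.e. every vertex of S has at most one neighbour inside S.
IsDissociation : {n : ℕ} → Graph n → Subset n → Set
IsDissociation G S =
  ∀ v u w → v ∈ S → u ∈ S → w ∈ S →
    adj G v u ≡ true → adj G v w ≡ true → u ≡ w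

DissNumber : {n : ℕ} → Graph n → ℕ → Set
DissNumber G k =
  (Σ (Subset _) λ S → IsDissociation G S × ∣ S ∣ ≡ k)
  × (∀ S → IsDissociation G S → ∣ S ∣ ≤ k)

p3adj : Fin 3 → Fin 3 → Bool
p3adj zero (suc zero) = true
p3adj (suc zero) zero = true
p3adj (suc zero) (suc (suc zero)) = true
p3adj (suc (suc zero)) (suc zero) = true
p3adj _ _ = false

attachAdj : {n : ℕ} → Graph n → Fin n → Fin 3 → Fin (n + 3) → Fin (n + 3) → Bool
attachAdj {n} G g p x y with splitAt n x | splitAt n y
... | inj₁ i | inj₁ j = adj G i j
... | inj₂ a | inj₂ b = p3adj a b
... | inj₁ i | inj₂ b = ⌊ i ≟ g ⌋ ∧ ⌊ b ≟ p ⌋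
... | inj₂ a | inj₁ j = ⌊ j ≟ g ⌋ ∧ ⌊ a ≟ p ⌋

private
  p3sym : ∀ a b → p3adj a b ≡ p3adj b a
  p3sym zero zero = _≡_.refl
  p3sym zero (suc zero) = _≡_.refl
  p3sym zero (suc (suc zero)) = _≡_.refl
  p3sym (suc zero) zero = _≡_.refl
  p3sym (suc zero) (suc zero) = _≡_.refl
  p3sym (suc zero) (suc (suc zero)) = _≡_.refl
  p3sym (suc (suc zero)) zero = _≡_.refl
  p3sym (suc (suc zero)) (suc zero) = _≡_.refl
  p3sym (suc (suc zero)) (suc (suc zero)) = _≡_.refl

  p3irr : ∀ a → p3adj a a ≡ false
  p3irr zero = _≡_.refl
  p3irr (suc zero) = _≡_.refl
  p3irr (suc (suc zero)) = _≡_.refl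

  attachSym : {n : ℕ} (G : Graph n) (g : Fin n) (p : Fin 3) (x y : Fin (n + 3)) → attachAdj G g p x y ≡ attachAdj G g p y x
  attachSym {n} G g p x y with splitAt n x | splitAt n y
  ... | inj₁ i | inj₁ j = sym G i j
  ... | inj₂ a | inj₂ b = p3sym a b
  ... | inj₁ i | inj₂ b = _≡_.refl
  ... | inj₂ a | inj₁ j = _≡_.refl

  attachIrr : {n : ℕ} (G : Graph n) (g : Fin n) (p : Fin 3) (x : Fin (n + 3)) → attachAdj G g p x x ≡ false
  attachIrr {n} G g p x with splitAt n x
  ... | inj₁ i = irrefl G i
  ... | inj₂ a = p3irr a

attachP3 : {n : ℕ} → Graph n → Fin n → Fin 3 → Graph (n + 3)
attachP3 G g p = record
  { adj = attachAdj G g p ; sym = attachSym G g p ; irrefl = attachIrr G g p }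

{-# OPTIONS --safe #-}
-- A dissociation set of G' splits into its parts in G and in P; the first has
-- at most diss(G) vertices and the second at most 2, since P itself is not a
-- dissociation set. Conversely, a maximum dissociation set of G together with
-- the two vertices of P other than its attachment vertex p is a dissociation
-- set of G': those two vertices induce at most one edge, and the only edge
-- leaving P ends at p.
module Submission where

open import Defs hiding (sym)
open import Data.Nat using (ℕ; suc; _+_; _∸_; _≤_; s≤s⁻¹)
open import Data.Nat.Properties using (+-mono-≤; m≤n⇒m<n∨m≡n; module ≤-Reasoning)
open import Data.Fin using (Fin; _↑ˡ_; _↑ʳ_; splitAt; _≟_)
open import Data.Fin.Properties using (all?; splitAt-↑ˡ; splitAt-↑ʳ; splitAt⁻¹-↑ˡ; splitAt⁻¹-↑ʳ; ↑ˡ-injective; ↑ʳ-injective)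
open import Data.Fin.Subset using (Subset; _∈_; ∣_∣; ⊤; ∁; ⁅_⁆)
open import Data.Fin.Subset.Properties using (_∈?_; ∣p∣≤n; ∣p∣≡n⇒p≡⊤; ∣∁p∣≡n∸∣p∣; ∣⁅x⁆∣≡1; x∈∁p⇒x∉p; x∉⁅y⁆⇒x≢y)
open import Data.Vec using ([]; _∷_; _++_)
import Data.Vec as Vec
open import Data.Vec.Properties using ([]=⇒lookup; lookup⇒[]=; lookup-++ˡ; lookup-++ʳ)
open import Data.Bool using (true; false)
import Data.Bool as Bool
open import Data.Bool.Properties using (∧-zeroʳ)
open import Data.Sum using (inj₁; inj₂)
open import Data.Product using (_,_)
open import Data.Empty using (⊥-elim)
open import Relation.Nullary using (Dec; _→-dec_)
open import Relation.Nullary.Decidable using (from-yes; from-no; dec-false; isYes≗does)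
open import Relation.Binary.PropositionalEquality using (_≡_; _≢_; refl; sym; trans; cong; cong₂; subst)

∣p++q∣≡∣p∣+∣q∣ : ∀ {m k} (p : Subset m) (q : Subset k) → ∣ p ++ q ∣ ≡ ∣ p ∣ + ∣ q ∣
∣p++q∣≡∣p∣+∣q∣ []          q = refl
∣p++q∣≡∣p∣+∣q∣ (true  ∷ p) q = cong suc (∣p++q∣≡∣p∣+∣q∣ p q)
∣p++q∣≡∣p∣+∣q∣ (false ∷ p) q = ∣p++q∣≡∣p∣+∣q∣ p q

module _ {m k} (p : Subset m) (q : Subset k) where

  ↑ˡ∈p++q⇒∈p : ∀ {i} → i ↑ˡ k ∈ p ++ q → i ∈ p
  ↑ˡ∈p++q⇒∈p {i} i∈ = lookup⇒[]= i p (trans (sym (lookup-++ˡ p q i)) ([]=⇒lookup i∈))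

  ↑ʳ∈p++q⇒∈q : ∀ {a} → m ↑ʳ a ∈ p ++ q → a ∈ q
  ↑ʳ∈p++q⇒∈q {a} a∈ = lookup⇒[]= a q (trans (sym (lookup-++ʳ p q a)) ([]=⇒lookup a∈))

  ∈p⇒↑ˡ∈p++q : ∀ {i} → i ∈ p → i ↑ˡ k ∈ p ++ q
  ∈p⇒↑ˡ∈p++q {i} i∈ = lookup⇒[]= (i ↑ˡ k) (p ++ q) (trans (lookup-++ˡ p q i) ([]=⇒lookup i∈))

  ∈q⇒↑ʳ∈p++q : ∀ {a} → a ∈ q → m ↑ʳ a ∈ p ++ q
  ∈q⇒↑ʳ∈p++q {a} a∈ = lookup⇒[]= (m ↑ʳ a) (p ++ q) (trans (lookup-++ʳ p q a) ([]=⇒lookup a∈))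

data Side (m k : ℕ) : Fin (m + k) → Set where
  left  : (i : Fin m) → Side m k (i ↑ˡ k)
  right : (a : Fin k) → Side m k (m ↑ʳ a)

side : ∀ m {k} (x : Fin (m + k)) → Side m k x
side m x with splitAt m x in eq
... | inj₁ i = subst (Side m _) (splitAt⁻¹-↑ˡ eq) (left i)
... | inj₂ a = subst (Side m _) (splitAt⁻¹-↑ʳ eq) (right a)

isDissociation? : ∀ {n} (G : Graph n) (S : Subset n) → Dec (IsDissociation G S)
isDissociation? G S = all? λ v → all? λ u → all? λ w →
  v ∈? S →-dec u ∈? S →-dec w ∈? S →-dec
  adj G v u Bool.≟ true →-dec adj G v w Bool.≟ true →-dec u ≟ w

module Split {m k} (Γ : Graph (m + k)) (G : Graph m) (H : Graph k)
  (adj-↑ˡ : ∀ i j → adj Γ (i ↑ˡ k) (j ↑ˡ k) ≡ adj G i j)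
  (adj-↑ʳ : ∀ a b → adj Γ (m ↑ʳ a) (m ↑ʳ b) ≡ adj H a b)
  where

  dissociation-++⁻ˡ : ∀ S T → IsDissociation Γ (S ++ T) → IsDissociation G S
  dissociation-++⁻ˡ S T diss v u w v∈ u∈ w∈ vu vw =
    ↑ˡ-injective k u w (diss (v ↑ˡ k) (u ↑ˡ k) (w ↑ˡ k)
      (∈p⇒↑ˡ∈p++q S T v∈) (∈p⇒↑ˡ∈p++q S T u∈) (∈p⇒↑ˡ∈p++q S T w∈)
      (trans (adj-↑ˡ v u) vu) (trans (adj-↑ˡ v w) vw))

  dissociation-++⁻ʳ : ∀ S T → IsDissociation Γ (S ++ T) → IsDissociation H T
  dissociation-++⁻ʳ S T diss v u w v∈ u∈ w∈ vu vw =
    ↑ʳ-injective m u w (diss (m ↑ʳ v) (m ↑ʳ u) (m ↑ʳ w)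
      (∈q⇒↑ʳ∈p++q S T v∈) (∈q⇒↑ʳ∈p++q S T u∈) (∈q⇒↑ʳ∈p++q S T w∈)
      (trans (adj-↑ʳ v u) vu) (trans (adj-↑ʳ v w) vw))

  NoEdgeInto : Subset k → Set
  NoEdgeInto T = ∀ i b → b ∈ T → adj Γ (i ↑ˡ k) (m ↑ʳ b) ≡ false

  no-edge : ∀ {T} → NoEdgeInto T → ∀ i {b} → b ∈ T → adj Γ (i ↑ˡ k) (m ↑ʳ b) ≢ true
  no-edge no-cross i b∈ edge with () ← trans (sym (no-cross i _ b∈)) edge

  dissociation-++⁺ : ∀ S T → NoEdgeInto T →
                     IsDissociation G S → IsDissociation H T → IsDissociation Γ (S ++ T)
  dissociation-++⁺ S T no-cross dissS dissT v u w v∈ u∈ w∈ vu vw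
    with side m v | side m u | side m w
  ... | left i  | left j  | left l  =
    cong (_↑ˡ k) (dissS i j l (↑ˡ∈p++q⇒∈p S T v∈) (↑ˡ∈p++q⇒∈p S T u∈) (↑ˡ∈p++q⇒∈p S T w∈)
      (trans (sym (adj-↑ˡ i j)) vu) (trans (sym (adj-↑ˡ i l)) vw))
  ... | right a | right b | right c =
    cong (m ↑ʳ_) (dissT a b c (↑ʳ∈p++q⇒∈q S T v∈) (↑ʳ∈p++q⇒∈q S T u∈) (↑ʳ∈p++q⇒∈q S T w∈)
      (trans (sym (adj-↑ʳ a b)) vu) (trans (sym (adj-↑ʳ a c)) vw))
  ... | left i  | right _ | _       = ⊥-elim (no-edge no-cross i (↑ʳ∈p++q⇒∈q S T u∈) vu)
  ... | left i  | left _  | right _ = ⊥-elim (no-edge no-cross i (↑ʳ∈p++q⇒∈q S T w∈) vw)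
  ... | right _ | left j  | _       =
    ⊥-elim (no-edge no-cross j (↑ʳ∈p++q⇒∈q S T v∈) (trans (Graph.sym Γ _ _) vu))
  ... | right _ | right _ | left l  =
    ⊥-elim (no-edge no-cross l (↑ʳ∈p++q⇒∈q S T v∈) (trans (Graph.sym Γ _ _) vw))

P₃ : Graph 3
P₃ = record
  { adj    = p3adj
  ; sym    = from-yes (all? λ a → all? λ b → p3adj a b Bool.≟ p3adj b a)
  ; irrefl = from-yes (all? λ a → p3adj a a Bool.≟ false)
  }

P₃-∁⁅p⁆-dissociation : ∀ p → IsDissociation P₃ (∁ ⁅ p ⁆)
P₃-∁⁅p⁆-dissociation = from-yes (all? λ p → isDissociation? P₃ (∁ ⁅ p ⁆))

∣∁⁅p⁆∣≡2 : (p : Fin 3) → ∣ ∁ ⁅ p ⁆ ∣ ≡ 2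
∣∁⁅p⁆∣≡2 p = trans (∣∁p∣≡n∸∣p∣ ⁅ p ⁆) (cong (3 ∸_) (∣⁅x⁆∣≡1 p))

P₃-dissociation-size : ∀ T → IsDissociation P₃ T → ∣ T ∣ ≤ 2
P₃-dissociation-size T diss with m≤n⇒m<n∨m≡n (∣p∣≤n T)
... | inj₁ ∣T∣<3 = s≤s⁻¹ ∣T∣<3
... | inj₂ ∣T∣≡3 = ⊥-elim (from-no (isDissociation? P₃ ⊤) (subst (IsDissociation P₃) (∣p∣≡n⇒p≡⊤ ∣T∣≡3) diss))

module _ {n} (G : Graph n) (g : Fin n) (p : Fin 3) where

  attachP3-↑ˡ : ∀ i j → adj (attachP3 G g p) (i ↑ˡ 3) (j ↑ˡ 3) ≡ adj G i j
  attachP3-↑ˡ i j rewrite splitAt-↑ˡ n i 3 | splitAt-↑ˡ n j 3 = refl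

  attachP3-↑ʳ : ∀ a b → adj (attachP3 G g p) (n ↑ʳ a) (n ↑ʳ b) ≡ adj P₃ a b
  attachP3-↑ʳ a b rewrite splitAt-↑ʳ n 3 a | splitAt-↑ʳ n 3 b = refl

  attachP3-cross : ∀ i b → b ≢ p → adj (attachP3 G g p) (i ↑ˡ 3) (n ↑ʳ b) ≡ false
  attachP3-cross i b b≢p rewrite splitAt-↑ˡ n i 3 | splitAt-↑ʳ n 3 b =
    trans (cong (_ Bool.∧_) (trans (isYes≗does (b ≟ p)) (dec-false (b ≟ p) b≢p))) (∧-zeroʳ _)

  open Split (attachP3 G g p) G P₃ attachP3-↑ˡ attachP3-↑ʳ public

  attachP3-dissociation : ∀ S → IsDissociation G S → IsDissociation (attachP3 G g p) (S ++ ∁ ⁅ p ⁆)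
  attachP3-dissociation S diss = dissociation-++⁺ S (∁ ⁅ p ⁆)
    (λ i b b∈ → attachP3-cross i b (x∉⁅y⁆⇒x≢y (x∈∁p⇒x∉p b∈)))
    diss (P₃-∁⁅p⁆-dissociation p)

lemma2p7 : (n : ℕ) (G : Graph n) → Connected G →
    (g : Fin n) (p : Fin 3) (k : ℕ) →
    DissNumber G k → DissNumber (attachP3 G g p) (k + 2)
lemma2p7 n G _ g p k ((S , S-diss , ∣S∣≡k) , S-max) =
  (S ++ ∁ ⁅ p ⁆ , attachP3-dissociation G g p S S-diss , ∣S++∁⁅p⁆∣≡k+2) , upper
  where
  ∣S++∁⁅p⁆∣≡k+2 : ∣ S ++ ∁ ⁅ p ⁆ ∣ ≡ k + 2
  ∣S++∁⁅p⁆∣≡k+2 = trans (∣p++q∣≡∣p∣+∣q∣ S (∁ ⁅ p ⁆)) (cong₂ _+_ ∣S∣≡k (∣∁⁅p⁆∣≡2 p))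

  upper : ∀ X → IsDissociation (attachP3 G g p) X → ∣ X ∣ ≤ k + 2
  upper X X-diss with Vec.splitAt n X
  ... | S′ , T′ , refl = begin
    ∣ S′ ++ T′ ∣    ≡⟨ ∣p++q∣≡∣p∣+∣q∣ S′ T′ ⟩
    ∣ S′ ∣ + ∣ T′ ∣ ≤⟨ +-mono-≤ (S-max S′ (dissociation-++⁻ˡ G g p S′ T′ X-diss))
                               (P₃-dissociation-size T′ (dissociation-++⁻ʳ G g p S′ T′ X-diss)) ⟩
    k + 2           ∎
    where open ≤-Reasoning
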